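{- Let $n\ge1$, let $T$ be the $n\times n$ cyclic shift matrix and $A(n)=3I_n-T^{ -1}-T$. Then (i) $\operatorname{coker}A(n)\cong\mathbb{Z}_{F_n}\oplus\mathbb{Z}_{5F_n}$ if $n$ is even; (ii) $\operatorname{coker}A(n)\cong\mathbb{Z}_{L_n}\oplus\mathbb{Z}_{L_n}$ if $n$ is odd, where $F_n$ and $L_n$ are the Fibonacci and Lucas numbers.
   Context: $T=\mathrm{circ}(0,1,0,\ldots,0)$ is the $n\times n$ permutation matrix of the cyclic shift ($T_{i,i+1}=1$, indices mod $n$). $\operatorname{coker}X=\mathbb{Z}^n/X\mathbb{Z}^n$ for an integer $n\times n$ matrix $X$; $\mathbb{Z}_1$ is the trivial group. $F_0=0,F_1=1,F_{n+1}=F_n+F_{n-1}$; $L_0=2,L_1=1,L_{n+1}=L_n+L_{n-1}$. -}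

module Defs where

open import Level using (0ℓ)
open import Data.Nat as ℕ using (ℕ; zero; suc; _%_)
open import Data.Fin using (Fin; zero; suc; toℕ)
open import Data.Integer using (ℤ; +_; _+_; _-_; -_; _*_; 0ℤ)
open import Data.Integer.Properties
  using (+-assoc; +-comm; +-identityˡ; +-identityʳ; +-inverseʳ; +-inverseˡ; *-distribˡ-+; neg-distrib-+; neg-distribʳ-*; *-zeroʳ)
open import Data.Product using (Σ; _,_; ∃)
open import Relation.Binary.PropositionalEquality
open import Relation.Nullary.Decidable using (does)
open import Data.Bool using (if_then_else_)
open import Algebra.Bundles using (AbelianGroup; RawGroup)
open import Algebra.Construct.DirectProduct using (abelianGroup)
import Algebra.Morphism.Structures as MS
open import Data.Integer.Solver using (module +-*-Solver)
open +-*-Solver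

Vec : ℕ → Set
Vec n = Fin n → ℤ

Mat : ℕ → Set
Mat n = Fin n → Fin n → ℤ

Σᶠ : ∀ {n} → (Fin n → ℤ) → ℤ
Σᶠ {zero}  f = 0ℤ
Σᶠ {suc n} f = f zero + Σᶠ (λ j → f (suc j))

_·_ : ∀ {n} → Mat n → Vec n → Vec n
(X · v) i = Σᶠ (λ j → X i j * v j)

-- Identity, cyclic shift T (T i (i+1 mod n) = 1) and its inverse T⁻¹
-- (T⁻¹ (i+1 mod n) i = 1, i.e. T⁻¹ is the transpose of T).
δ : ℕ → ℕ → ℤ
δ a b = if does (a ℕ.≟ b) then + 1 else 0ℤ

I : (n : ℕ) → Mat n
I n i j = δ (toℕ i) (toℕ j)

T : (n : ℕ) → Mat n
T n i j = δ (toℕ j) ((suc (toℕ i)) % suc (ℕ.pred n))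

T⁻¹ : (n : ℕ) → Mat n
T⁻¹ n i j = δ (toℕ i) ((suc (toℕ j)) % suc (ℕ.pred n))

A : (n : ℕ) → Mat n
A n i j = + 3 * I n i j - T⁻¹ n i j - T n i j

fib : ℕ → ℕ
fib 0 = 0
fib 1 = 1
fib (suc (suc n)) = fib (suc n) ℕ.+ fib n

lucas : ℕ → ℕ
lucas 0 = 2
lucas 1 = 1
lucas (suc (suc n)) = lucas (suc n) ℕ.+ lucas n

Σᶠ-cong : ∀ {n} {f g : Fin n → ℤ} → (∀ j → f j ≡ g j) → Σᶠ f ≡ Σᶠ g
Σᶠ-cong {zero}  e = refl
Σᶠ-cong {suc n} e = cong₂ _+_ (e zero) (Σᶠ-cong (λ j → e (suc j)))

Σᶠ-+ : ∀ {n} (f g : Fin n → ℤ) → Σᶠ (λ j → f j + g j) ≡ Σᶠ f + Σᶠ g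
Σᶠ-+ {zero}  f g = refl
Σᶠ-+ {suc n} f g = trans (cong (λ t → (f zero + g zero) + t) (Σᶠ-+ (λ j → f (suc j)) (λ j → g (suc j))))
  (solve 4 (λ a b c d → (a :+ b) :+ (c :+ d) := (a :+ c) :+ (b :+ d)) refl
    (f zero) (g zero) (Σᶠ (λ j → f (suc j))) (Σᶠ (λ j → g (suc j))))

Σᶠ-neg : ∀ {n} (f : Fin n → ℤ) → Σᶠ (λ j → - f j) ≡ - Σᶠ f
Σᶠ-neg {zero}  f = refl
Σᶠ-neg {suc n} f = trans (cong (λ t → - f zero + t) (Σᶠ-neg (λ j → f (suc j))))
  (sym (neg-distrib-+ (f zero) (Σᶠ (λ j → f (suc j)))))

Σᶠ-0 : ∀ {n} → Σᶠ {n} (λ _ → 0ℤ) ≡ 0ℤ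
Σᶠ-0 {zero}  = refl
Σᶠ-0 {suc n} = cong (λ t → 0ℤ + t) (Σᶠ-0 {n})

·-+ : ∀ {n} (X : Mat n) (u v : Vec n) i → (X · (λ j → u j + v j)) i ≡ (X · u) i + (X · v) i
·-+ X u v i = trans (Σᶠ-cong (λ j → *-distribˡ-+ (X i j) (u j) (v j)))
                    (Σᶠ-+ (λ j → X i j * u j) (λ j → X i j * v j))

·-neg : ∀ {n} (X : Mat n) (u : Vec n) i → (X · (λ j → - u j)) i ≡ - (X · u) i
·-neg X u i = trans (Σᶠ-cong (λ j → sym (neg-distribʳ-* (X i j) (u j)))) (Σᶠ-neg (λ j → X i j * u j))

·-0 : ∀ {n} (X : Mat n) i → (X · (λ _ → 0ℤ)) i ≡ 0ℤ
·-0 {n} X i = trans (Σᶠ-cong (λ j → *-zeroʳ (X i j))) (Σᶠ-0 {n})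

-- The cokernel ℤⁿ / X ℤⁿ as an abelian group (setoid quotient):
-- x ≈ y  iff  x - y ∈ X ℤⁿ

module _ {n : ℕ} (X : Mat n) where

  _≈ᶜ_ : Vec n → Vec n → Set
  x ≈ᶜ y = Σ (Vec n) λ v → ∀ i → x i - y i ≡ (X · v) i

  private
    ≡⇒≈ : ∀ {x y : Vec n} → (∀ i → x i ≡ y i) → x ≈ᶜ y
    ≡⇒≈ {x} {y} e = (λ _ → 0ℤ) , λ i →
      trans (cong (λ t → x i - t) (sym (e i))) (trans (solve 1 (λ a → a :- a := con 0ℤ) refl (x i)) (sym (·-0 X i)))

    ≈-sym : ∀ {x y} → x ≈ᶜ y → y ≈ᶜ x
    ≈-sym {x} {y} (v , p) = (λ j → - v j) , λ i →
      trans (solve 2 (λ a b → b :- a := :- (a :- b)) refl (x i) (y i))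
            (trans (cong -_ (p i)) (sym (·-neg X v i)))

    ≈-trans : ∀ {x y z} → x ≈ᶜ y → y ≈ᶜ z → x ≈ᶜ z
    ≈-trans {x} {y} {z} (v , p) (w , q) = (λ j → v j + w j) , λ i →
      trans (solve 3 (λ a b c → a :- c := (a :- b) :+ (b :- c)) refl (x i) (y i) (z i))
            (trans (cong₂ _+_ (p i) (q i)) (sym (·-+ X v w i)))

    +-cong : ∀ {x y u w} → x ≈ᶜ y → u ≈ᶜ w → (λ i → x i + u i) ≈ᶜ (λ i → y i + w i)
    +-cong {x} {y} {u} {w} (v , p) (v' , q) = (λ j → v j + v' j) , λ i →
      trans (solve 4 (λ a b c d → (a :+ c) :- (b :+ d) := (a :- b) :+ (c :- d)) refl (x i) (y i) (u i) (w i))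
            (trans (cong₂ _+_ (p i) (q i)) (sym (·-+ X v v' i)))

    neg-cong : ∀ {x y} → x ≈ᶜ y → (λ i → - x i) ≈ᶜ (λ i → - y i)
    neg-cong {x} {y} (v , p) = (λ j → - v j) , λ i →
      trans (solve 2 (λ a b → (:- a) :- (:- b) := :- (a :- b)) refl (x i) (y i))
            (trans (cong -_ (p i)) (sym (·-neg X v i)))

  Coker : AbelianGroup 0ℓ 0ℓ
  Coker = record
    { Carrier = Vec n
    ; _≈_ = _≈ᶜ_
    ; _∙_ = λ x y i → x i + y i
    ; ε = λ _ → 0ℤ
    ; _⁻¹ = λ x i → - x i
    ; isAbelianGroup = record
      { isGroup = record
        { isMonoid = record
          { isSemigroup = record
            { isMagma = record
              { isEquivalence = record
                { refl = λ {x} → ≡⇒≈ {x} {x} (λ _ → refl)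
                ; sym = λ {x} {y} → ≈-sym {x} {y}
                ; trans = λ {x} {y} {z} → ≈-trans {x} {y} {z} }
              ; ∙-cong = λ {x} {y} {u} {w} → +-cong {x} {y} {u} {w} }
            ; assoc = λ x y z → ≡⇒≈ {λ i → (x i + y i) + z i} {λ i → x i + (y i + z i)} (λ i → +-assoc (x i) (y i) (z i)) }
          ; identity = (λ x → ≡⇒≈ {λ i → 0ℤ + x i} {x} (λ i → +-identityˡ (x i)))
                     , (λ x → ≡⇒≈ {λ i → x i + 0ℤ} {x} (λ i → +-identityʳ (x i))) }
        ; inverse = (λ x → ≡⇒≈ {λ i → - x i + x i} {λ _ → 0ℤ} (λ i → +-inverseˡ (x i)))
                  , (λ x → ≡⇒≈ {λ i → x i + - x i} {λ _ → 0ℤ} (λ i → +-inverseʳ (x i)))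
        ; ⁻¹-cong = λ {x} {y} → neg-cong {x} {y} }
      ; comm = λ x y → ≡⇒≈ {λ i → x i + y i} {λ i → y i + x i} (λ i → +-comm (x i) (y i)) }
    }

ℤ/ : ℕ → AbelianGroup 0ℓ 0ℓ
ℤ/ k = Coker {1} (λ _ _ → + k)

_⊕_ : AbelianGroup 0ℓ 0ℓ → AbelianGroup 0ℓ 0ℓ → AbelianGroup 0ℓ 0ℓ
G ⊕ H = abelianGroup G H

_≅_ : AbelianGroup 0ℓ 0ℓ → AbelianGroup 0ℓ 0ℓ → Set
G ≅ H = ∃ λ (f : AbelianGroup.Carrier G → AbelianGroup.Carrier H) →
  MS.GroupMorphisms.IsGroupIsomorphism (AbelianGroup.rawGroup G) (AbelianGroup.rawGroup H) f

-- The cycle disturbs the recurrence V(k+2) = 3 V(k+1) - V(k) only at the wrap-around: A(n) maps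
-- the restriction of any solution V to ∂₀ V · e₀ + ∂₁ V · eₙ₋₁.  Its columns express every eₖ
-- through e₀ and eₙ₋₁ modulo the image, so coker A(n) is ℤ² modulo the boundary values
-- (∂₀ , ∂₁) of the solutions; and since A(n) is symmetric, a solution whose boundary values
-- vanish mod a is a functional ℤⁿ → ℤ/a killing the image.  The solutions are q F₂ₘ - p F₂ₘ₋₂
-- (m = n - 1), and by Cassini's identity the boundary matrix is Lₙ times a unimodular matrix for
-- odd n, and Fₙ times a matrix of determinant 5 for even n.  Bases adapted to these
-- factorisations split the cokernel as ℤ/Lₙ ⊕ ℤ/Lₙ, respectively ℤ/Fₙ ⊕ ℤ/5Fₙ.

module Submission where

open import Defs
open import Data.Nat as ℕ using (ℕ; zero; suc; _≤_; _<_; z≤n; s≤s; _%_)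
import Data.Nat.Properties as ℕₚ
open import Data.Nat.DivMod using (m<n⇒m%n≡m; n%n≡0; m%n<n; [m+kn]%n≡m%n)
open import Data.Fin using (Fin; zero; suc; toℕ; fromℕ<)
open import Data.Fin.Properties using (toℕ-fromℕ<; toℕ<n)
open import Data.Integer using (ℤ; +_; _+_; _-_; -_; _*_; 0ℤ; 1ℤ; -1ℤ)
open import Data.Integer.Properties
  using ( pos-*; -1*i≡-i; *-comm; *-zeroʳ; *-identityˡ; *-identityʳ; +-identityˡ; +-identityʳ
        ; +-inverseʳ; *-distribˡ-+; neg-distribʳ-*)
open import Data.Integer.Divisibility.Signed
  using (_∣_; divides; ∣m∣n⇒∣m+n; ∣m∣n⇒∣m-n; ∣n⇒∣m*n; ∣m⇒∣m*n; ∣m⇒∣-m)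
open import Data.Integer.Tactic.RingSolver using (solve-∀)
open import Data.Product using (Σ; ∃; ∃₂; _,_; _×_; proj₁; proj₂)
open import Data.Sum using (_⊎_; inj₁; inj₂)
open import Algebra.Bundles using (AbelianGroup)
open import Relation.Binary.PropositionalEquality
open import Relation.Nullary using (yes; no; contradiction)
open import Function using (_∘_)
open ≡-Reasoning

δ-sym : ∀ a b → δ a b ≡ δ b a
δ-sym zero    zero    = refl
δ-sym zero    (suc b) = refl
δ-sym (suc a) zero    = refl
δ-sym (suc a) (suc b) = δ-sym a b

Σᶠ-*ˡ : ∀ {n} k (f : Fin n → ℤ) → Σᶠ (λ j → k * f j) ≡ k * Σᶠ f
Σᶠ-*ˡ {zero}  k f = sym (*-zeroʳ k)
Σᶠ-*ˡ {suc n} k f = trans (cong (_+_ (k * f zero)) (Σᶠ-*ˡ k (λ j → f (suc j))))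
                          (sym (*-distribˡ-+ k (f zero) _))

Σᶠ-comm : ∀ {m n} (f : Fin m → Fin n → ℤ) →
          Σᶠ (λ i → Σᶠ (λ j → f i j)) ≡ Σᶠ (λ j → Σᶠ (λ i → f i j))
Σᶠ-comm {zero}  {n} f = sym (Σᶠ-0 {n})
Σᶠ-comm {suc m} f = trans (cong (_+_ (Σᶠ (f zero))) (Σᶠ-comm (λ i → f (suc i))))
                          (sym (Σᶠ-+ (f zero) (λ j → Σᶠ (λ i → f (suc i) j))))

Σᶠ-δ : ∀ {n} (j : Fin n) (f : Fin n → ℤ) → Σᶠ (λ l → δ (toℕ l) (toℕ j) * f l) ≡ f j
Σᶠ-δ {suc n} zero f = trans (cong₂ _+_ (*-identityˡ (f zero)) (Σᶠ-0 {n})) (+-identityʳ (f zero))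
Σᶠ-δ {suc n} (suc j) f = trans (+-identityˡ _) (Σᶠ-δ j (λ l → f (suc l)))

Σᶠ-∣ : ∀ {n} {k} (f : Fin n → ℤ) → (∀ j → k ∣ f j) → k ∣ Σᶠ f
Σᶠ-∣ {zero}  f _ = divides 0ℤ refl
Σᶠ-∣ {suc n} f k∣f = ∣m∣n⇒∣m+n (k∣f zero) (Σᶠ-∣ (λ j → f (suc j)) (λ j → k∣f (suc j)))

Σᶠ-*ʳ : ∀ {n} k (f : Fin n → ℤ) → Σᶠ (λ j → f j * k) ≡ Σᶠ f * k
Σᶠ-*ʳ {n} k f = begin
  Σᶠ (λ j → f j * k) ≡⟨ Σᶠ-cong {n} (λ j → *-comm (f j) k) ⟩
  Σᶠ (λ j → k * f j) ≡⟨ Σᶠ-*ˡ k f ⟩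
  k * Σᶠ f           ≡⟨ *-comm k (Σᶠ f) ⟩
  Σᶠ f * k           ∎

⟨_,_⟩ : ∀ {n} → Vec n → Vec n → ℤ
⟨ c , x ⟩ = Σᶠ (λ i → c i * x i)

e : ∀ {n} → ℕ → Vec n
e k j = δ (toℕ j) k

module _ {n : ℕ} (c : Vec n) where

  ⟨⟩-+ʳ : ∀ x y → ⟨ c , (λ i → x i + y i) ⟩ ≡ ⟨ c , x ⟩ + ⟨ c , y ⟩
  ⟨⟩-+ʳ x y = trans (Σᶠ-cong {n} (λ i → *-distribˡ-+ (c i) (x i) (y i))) (Σᶠ-+ {n} _ _)

  ⟨⟩-negʳ : ∀ x → ⟨ c , (λ i → - x i) ⟩ ≡ - ⟨ c , x ⟩
  ⟨⟩-negʳ x = trans (Σᶠ-cong {n} (λ i → sym (neg-distribʳ-* (c i) (x i)))) (Σᶠ-neg {n} _)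

  ⟨⟩-−ʳ : ∀ x y → ⟨ c , x ⟩ - ⟨ c , y ⟩ ≡ ⟨ c , (λ i → x i - y i) ⟩
  ⟨⟩-−ʳ x y = sym (trans (⟨⟩-+ʳ x (λ i → - y i)) (cong (_+_ ⟨ c , x ⟩) (⟨⟩-negʳ y)))

  ⟨⟩-0ʳ : ⟨ c , (λ _ → 0ℤ) ⟩ ≡ 0ℤ
  ⟨⟩-0ʳ = trans (Σᶠ-cong {n} (λ i → *-zeroʳ (c i))) (Σᶠ-0 {n})

  ⟨⟩-*ʳ : ∀ k x → ⟨ c , (λ i → k * x i) ⟩ ≡ k * ⟨ c , x ⟩
  ⟨⟩-*ʳ k x = trans (Σᶠ-cong {n} (λ i → *-swapˡ (c i) k (x i))) (Σᶠ-*ˡ {n} k _)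
    where
    *-swapˡ : ∀ a b c → a * (b * c) ≡ b * (a * c)
    *-swapˡ = solve-∀

  ⟨⟩-linʳ : ∀ p q x y → ⟨ c , (λ i → p * x i + q * y i) ⟩ ≡ p * ⟨ c , x ⟩ + q * ⟨ c , y ⟩
  ⟨⟩-linʳ p q x y = trans (⟨⟩-+ʳ _ _) (cong₂ _+_ (⟨⟩-*ʳ p x) (⟨⟩-*ʳ q y))

  ⟨⟩-∣ : ∀ {k} x → (∀ i → k ∣ c i) → k ∣ ⟨ c , x ⟩
  ⟨⟩-∣ x k∣c = Σᶠ-∣ {n} _ (λ i → ∣m⇒∣m*n (x i) (k∣c i))

⟨⟩-symmetric : ∀ {n} (M : Mat n) → (∀ i j → M i j ≡ M j i) →
               ∀ c v → ⟨ c , M · v ⟩ ≡ ⟨ M · c , v ⟩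
⟨⟩-symmetric {n} M M-sym c v = begin
  Σᶠ (λ i → c i * Σᶠ (λ j → M i j * v j))       ≡⟨ Σᶠ-cong {n} (λ i → sym (Σᶠ-*ˡ {n} (c i) _)) ⟩
  Σᶠ (λ i → Σᶠ (λ j → c i * (M i j * v j)))     ≡⟨ Σᶠ-comm {n} {n} _ ⟩
  Σᶠ (λ j → Σᶠ (λ i → c i * (M i j * v j)))
    ≡⟨ Σᶠ-cong {n} (λ j → Σᶠ-cong {n} (λ i → transpose (c i) (v j) (M-sym i j))) ⟩
  Σᶠ (λ j → Σᶠ (λ i → M j i * c i * v j))       ≡⟨ Σᶠ-cong {n} (λ j → Σᶠ-*ʳ {n} (v j) _) ⟩
  Σᶠ (λ j → Σᶠ (λ i → M j i * c i) * v j)       ∎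
  where
  reassoc : ∀ a b c → a * (b * c) ≡ b * a * c
  reassoc = solve-∀
  transpose : ∀ {x y} a b → x ≡ y → a * (x * b) ≡ y * a * b
  transpose {x} a b refl = reassoc a x b

-- Cokernels split by two functionals

module _ {n : ℕ} (M : Mat n) where

  Im : Vec n → Set
  Im x = Σ (Vec n) λ v → ∀ i → x i ≡ (M · v) i

  Im-resp : ∀ {x y} → (∀ i → x i ≡ y i) → Im x → Im y
  Im-resp x≗y (v , x≡Mv) = v , λ i → trans (sym (x≗y i)) (x≡Mv i)

  Im-0 : Im (λ _ → 0ℤ)
  Im-0 = (λ _ → 0ℤ) , λ i → sym (·-0 M i)

  Im-lin : ∀ p q {x y} → Im x → Im y → Im (λ i → p * x i + q * y i)
  Im-lin p q (v , x≡Mv) (v′ , y≡Mv′) =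
    (λ j → p * v j + q * v′ j) ,
    λ i → trans (cong₂ (λ a b → p * a + q * b) (x≡Mv i) (y≡Mv′ i)) (sym (⟨⟩-linʳ (M i) p q v v′))

  Spanned : Vec n → Vec n → Vec n → Set
  Spanned u w x = ∃₂ λ s t → Im (λ i → x i - (s * u i + t * w i))

  module _ {u w : Vec n} where

    Spanned-lin : ∀ p q {x y z x′} → Spanned u w x → Spanned u w y → Im z →
                  (∀ i → x′ i ≡ p * x i + q * y i + z i) → Spanned u w x′
    Spanned-lin p q {x} {y} {z} (s , t , hx) (s′ , t′ , hy) hz x′≗ =
      p * s + q * s′ , p * t + q * t′ ,
      Im-resp (λ i → sym (trans (cong (_- _) (x′≗ i))
                                (regroup p q (x i) (y i) (z i) s t s′ t′ (u i) (w i))))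
              (Im-lin 1ℤ 1ℤ (Im-lin p q hx hy) hz)
      where
      regroup : ∀ p q x y z s t s′ t′ u w →
                p * x + q * y + z - ((p * s + q * s′) * u + (p * t + q * t′) * w)
                ≡ 1ℤ * (p * (x - (s * u + t * w)) + q * (y - (s′ * u + t′ * w))) + 1ℤ * z
      regroup = solve-∀

    Spanned-Σ : ∀ {m} (g : Fin m → ℤ) (f : Fin m → Vec n) → (∀ k → Spanned u w (f k)) →
                Spanned u w (λ i → Σᶠ (λ k → g k * f k i))
    Spanned-Σ {zero}  g f _  = 0ℤ , 0ℤ , Im-0
    Spanned-Σ {suc m} g f hf =
      Spanned-lin (g zero) 1ℤ (hf zero)
        (Spanned-Σ (λ k → g (suc k)) (λ k → f (suc k)) (λ k → hf (suc k))) Im-0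
        (λ i → sym (trans (+-identityʳ _) (cong (_+_ (g zero * f zero i)) (*-identityˡ _))))

    Spanned-resp : ∀ {x y} → (∀ i → x i ≡ y i) → Spanned u w x → Spanned u w y
    Spanned-resp x≗y (s , t , h) = s , t , Im-resp (λ i → cong (_- _) (x≗y i)) h

    spanned-by-basis : (∀ (k : Fin n) → Spanned u w (e (toℕ k))) → ∀ x → Spanned u w x
    spanned-by-basis he x = Spanned-resp expand (Spanned-Σ x (λ k → e (toℕ k)) he)
      where
      expand : ∀ i → Σᶠ (λ k → x k * δ (toℕ i) (toℕ k)) ≡ x i
      expand i = trans (Σᶠ-cong {n} (λ k → trans (*-comm (x k) _) (cong (_* x k) (δ-sym (toℕ i) (toℕ k)))))
                       (Σᶠ-δ i x)

∣⇒≈ℤ/ : ∀ {a} {x y : Vec 1} → + a ∣ x zero - y zero → AbelianGroup._≈_ (ℤ/ a) x y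
∣⇒≈ℤ/ (divides q eq) = (λ _ → q) , λ { zero → trans eq (trans (*-comm q _) (sym (+-identityʳ _))) }

≈ℤ/⇒∣ : ∀ {a} {x y : Vec 1} → AbelianGroup._≈_ (ℤ/ a) x y → + a ∣ x zero - y zero
≈ℤ/⇒∣ (v , h) = divides (v zero) (trans (h zero) (trans (+-identityʳ _) (*-comm _ (v zero))))

-- x ↦ (⟨ c , x ⟩ mod a , ⟨ d , x ⟩ mod b) is then an isomorphism, inverse to (s , t) ↦ s u + t w.
record CokerSplitting {n : ℕ} (M : Mat n) (a b : ℕ) : Set where
  field
    c d u w  : Vec n
    c-image  : ∀ v → + a ∣ ⟨ c , M · v ⟩
    d-image  : ∀ v → + b ∣ ⟨ d , M · v ⟩
    au-image : Im M (λ i → + a * u i)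
    bw-image : Im M (λ i → + b * w i)
    c-u      : + a ∣ ⟨ c , u ⟩ - 1ℤ
    c-w      : + a ∣ ⟨ c , w ⟩
    d-u      : + b ∣ ⟨ d , u ⟩
    d-w      : + b ∣ ⟨ d , w ⟩ - 1ℤ
    spans    : ∀ (k : Fin n) → Spanned M u w (e (toℕ k))

module _ {n : ℕ} {M : Mat n} {a b : ℕ} (S : CokerSplitting M a b) where
  open CokerSplitting S

  private
    ψ : ℤ → ℤ → Vec n
    ψ s t i = s * u i + t * w i

    φ : Vec n → Vec 1 × Vec 1
    φ x = (λ _ → ⟨ c , x ⟩) , (λ _ → ⟨ d , x ⟩)

    image-∣ : ∀ {k} f → (∀ v → k ∣ ⟨ f , M · v ⟩) → ∀ {z} → Im M z → k ∣ ⟨ f , z ⟩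
    image-∣ f f-image (v , z≡Mv) =
      subst (_ ∣_) (Σᶠ-cong {n} (λ i → cong (f i *_) (sym (z≡Mv i)))) (f-image v)

    cong-∣ : ∀ {k} f → (∀ v → k ∣ ⟨ f , M · v ⟩) → ∀ x y → _≈ᶜ_ M x y → k ∣ ⟨ f , x ⟩ - ⟨ f , y ⟩
    cong-∣ f f-image x y x≈y = subst (_ ∣_) (sym (⟨⟩-−ʳ f x y)) (image-∣ f f-image x≈y)

    c-ψ : ∀ s t → + a ∣ ⟨ c , ψ s t ⟩ - s
    c-ψ s t = subst (_ ∣_) (sym (trans (cong (_- s) (⟨⟩-linʳ c s t u w)) (regroup s t ⟨ c , u ⟩ ⟨ c , w ⟩)))
                (∣m∣n⇒∣m+n (∣n⇒∣m*n s c-u) (∣n⇒∣m*n t c-w))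
      where
      regroup : ∀ s t x y → s * x + t * y - s ≡ s * (x - 1ℤ) + t * y
      regroup = solve-∀

    d-ψ : ∀ s t → + b ∣ ⟨ d , ψ s t ⟩ - t
    d-ψ s t = subst (_ ∣_) (sym (trans (cong (_- t) (⟨⟩-linʳ d s t u w)) (regroup s t ⟨ d , u ⟩ ⟨ d , w ⟩)))
                (∣m∣n⇒∣m+n (∣n⇒∣m*n s d-u) (∣n⇒∣m*n t d-w))
      where
      regroup : ∀ s t x y → s * x + t * y - t ≡ s * x + t * (y - 1ℤ)
      regroup = solve-∀

    through-ψ : ∀ {k} f → (∀ v → k ∣ ⟨ f , M · v ⟩) → ∀ z s t r →
                _≈ᶜ_ M z (ψ s t) → k ∣ ⟨ f , ψ s t ⟩ - r → k ∣ ⟨ f , z ⟩ - r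
    through-ψ f f-image z s t r z≈ψ k∣ψ = subst (_ ∣_) (sym (split ⟨ f , z ⟩ ⟨ f , ψ s t ⟩ r))
                                                (∣m∣n⇒∣m+n (cong-∣ f f-image z (ψ s t) z≈ψ) k∣ψ)
      where
      split : ∀ x y r → x - r ≡ (x - y) + (y - r)
      split = solve-∀

    ∣-cancel : ∀ {k} x r → k ∣ x → k ∣ x - r → k ∣ r
    ∣-cancel x r k∣x k∣x-r = subst (_ ∣_) (x-[x-r] x r) (∣m∣n⇒∣m-n k∣x k∣x-r)
      where
      x-[x-r] : ∀ x r → x - (x - r) ≡ r
      x-[x-r] = solve-∀

    ≡⇒≈ℤ/ : ∀ {k x y} → x ≡ y → AbelianGroup._≈_ (ℤ/ k) (λ _ → x) (λ _ → y)
    ≡⇒≈ℤ/ {k} {x} refl = ∣⇒≈ℤ/ {k} {λ _ → x} {λ _ → x} (divides 0ℤ (+-inverseʳ x))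

    φ-cong : ∀ {x y} → _≈ᶜ_ M x y → AbelianGroup._≈_ (ℤ/ a ⊕ ℤ/ b) (φ x) (φ y)
    φ-cong {x} {y} x≈y = ∣⇒≈ℤ/ {a} {proj₁ (φ x)} {proj₁ (φ y)} (cong-∣ c c-image x y x≈y)
                       , ∣⇒≈ℤ/ {b} {proj₂ (φ x)} {proj₂ (φ y)} (cong-∣ d d-image x y x≈y)

    ψ-image : ∀ {s t} → + a ∣ s → + b ∣ t → Im M (ψ s t)
    ψ-image (divides qs refl) (divides qt refl) =
      Im-resp M (λ i → regroup qs qt (+ a) (+ b) (u i) (w i)) (Im-lin M qs qt au-image bw-image)
      where
      regroup : ∀ p q a b u w → p * (a * u) + q * (b * w) ≡ p * a * u + q * b * w
      regroup = solve-∀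

    -- Write x − y ≡ s u + t w; then s and t are the coordinates of φ x − φ y, which vanish.
    φ-injective : ∀ {x y} → AbelianGroup._≈_ (ℤ/ a ⊕ ℤ/ b) (φ x) (φ y) → _≈ᶜ_ M x y
    φ-injective {x} {y} (φ₁x≈φ₁y , φ₂x≈φ₂y) with spanned-by-basis M spans (λ i → x i - y i)
    ... | s , t , x-y≈ψ =
      Im-resp M (λ i → reassemble (x-y i) (ψ s t i)) (Im-lin M 1ℤ 1ℤ x-y≈ψ (ψ-image a∣s b∣t))
      where
      x-y : Vec n
      x-y i = x i - y i
      reassemble : ∀ z p → 1ℤ * (z - p) + 1ℤ * p ≡ z
      reassemble = solve-∀
      a∣s : + a ∣ s
      a∣s = ∣-cancel _ s (subst (_ ∣_) (⟨⟩-−ʳ c x y) (≈ℤ/⇒∣ {a} {proj₁ (φ x)} {proj₁ (φ y)} φ₁x≈φ₁y))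
                         (through-ψ c c-image x-y s t s x-y≈ψ (c-ψ s t))
      b∣t : + b ∣ t
      b∣t = ∣-cancel _ t (subst (_ ∣_) (⟨⟩-−ʳ d x y) (≈ℤ/⇒∣ {b} {proj₂ (φ x)} {proj₂ (φ y)} φ₂x≈φ₂y))
                         (through-ψ d d-image x-y s t t x-y≈ψ (d-ψ s t))

    φ-surjective : ∀ s t {z} → _≈ᶜ_ M z (ψ (s zero) (t zero)) →
                   AbelianGroup._≈_ (ℤ/ a ⊕ ℤ/ b) (φ z) (s , t)
    φ-surjective s t {z} z≈ψ =
        ∣⇒≈ℤ/ {a} {proj₁ (φ z)} {s} (through-ψ c c-image z s₀ t₀ s₀ z≈ψ (c-ψ s₀ t₀))
      , ∣⇒≈ℤ/ {b} {proj₂ (φ z)} {t} (through-ψ d d-image z s₀ t₀ t₀ z≈ψ (d-ψ s₀ t₀))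
      where
      s₀ = s zero
      t₀ = t zero

  splitting⇒≅ : Coker M ≅ (ℤ/ a ⊕ ℤ/ b)
  splitting⇒≅ = φ , record
    { isGroupMonomorphism = record
      { isGroupHomomorphism = record
        { isMonoidHomomorphism = record
          { isMagmaHomomorphism = record
            { isRelHomomorphism = record { cong = φ-cong }
            ; homo = λ x y → ≡⇒≈ℤ/ {a} (⟨⟩-+ʳ c x y) , ≡⇒≈ℤ/ {b} (⟨⟩-+ʳ d x y) }
          ; ε-homo = ≡⇒≈ℤ/ {a} (⟨⟩-0ʳ c) , ≡⇒≈ℤ/ {b} (⟨⟩-0ʳ d) }
        ; ⁻¹-homo = λ x → ≡⇒≈ℤ/ {a} (⟨⟩-negʳ c x) , ≡⇒≈ℤ/ {b} (⟨⟩-negʳ d x) }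
      ; injective = φ-injective }
    ; surjective = λ (s , t) → ψ (s zero) (t zero) , φ-surjective s t
    }

-- The matrix A(n) on solutions of the recurrence

δ-refl : ∀ a → δ a a ≡ 1ℤ
δ-refl zero    = refl
δ-refl (suc a) = δ-refl a

δ-≢ : ∀ {a b} → a ≢ b → δ a b ≡ 0ℤ
δ-≢ {zero}  {zero}  a≢b = contradiction refl a≢b
δ-≢ {zero}  {suc b} _   = refl
δ-≢ {suc a} {zero}  _   = refl
δ-≢ {suc a} {suc b} a≢b = δ-≢ (a≢b ∘ cong suc)

next : ℕ → ℕ → ℕ
next m t = suc t % suc m

prev : ℕ → ℕ → ℕ
prev m zero    = m
prev m (suc t) = t

next-< : ∀ {m t} → t < m → next m t ≡ suc t
next-< t<m = m<n⇒m%n≡m (s≤s t<m)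

next-last : ∀ m → next m m ≡ 0
next-last m = n%n≡0 (suc m)

prev-≤ : ∀ {m t} → t ≤ m → prev m t ≤ m
prev-≤ {t = zero}  _         = ℕₚ.≤-refl
prev-≤ {t = suc t} (s≤s t≤m) = ℕₚ.m≤n⇒m≤1+n t≤m

δ-prev-next : ∀ {m t k} → t ≤ m → k ≤ m → δ (prev m t) k ≡ δ t (next m k)
δ-prev-next {m} {t} {k} t≤m k≤m with k ℕ.≟ m
... | yes refl rewrite next-last k = wrap t t≤m
  where
  wrap : ∀ t → t ≤ k → δ (prev k t) k ≡ δ t 0
  wrap zero    _   = δ-refl k
  wrap (suc t) t<k = δ-≢ (ℕₚ.<⇒≢ t<k)
... | no k≢m rewrite next-< (ℕₚ.≤∧≢⇒< k≤m k≢m) = step t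
  where
  step : ∀ t → δ (prev m t) k ≡ δ t (suc k)
  step zero    = δ-≢ (k≢m ∘ sym)
  step (suc t) = refl

_↾ : ∀ {n} → (ℕ → ℤ) → Vec n
(V ↾) j = V (toℕ j)

Σᶠ-δ↾ : ∀ {n k} (V : ℕ → ℤ) → k < n → Σᶠ {n} (λ l → δ (toℕ l) k * V (toℕ l)) ≡ V k
Σᶠ-δ↾ {n} V k<n = subst (λ r → Σᶠ {n} (λ l → δ (toℕ l) r * V (toℕ l)) ≡ V r)
                        (toℕ-fromℕ< k<n) (Σᶠ-δ (fromℕ< k<n) (V ↾))

A·≡ : ∀ n (v : Vec n) i → (A n · v) i ≡ + 3 * (I n · v) i - (T⁻¹ n · v) i - (T n · v) i
A·≡ n v i = begin
  Σᶠ (λ l → (+ 3 * I n i l - T⁻¹ n i l - T n i l) * v l)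
    ≡⟨ Σᶠ-cong {n} (λ l → expand (I n i l) (T⁻¹ n i l) (T n i l) (v l)) ⟩
  Σᶠ (λ l → + 3 * (I n i l * v l) + (- (T⁻¹ n i l * v l) + - (T n i l * v l)))
    ≡⟨ trans (Σᶠ-+ {n} _ _) (cong₂ _+_ (Σᶠ-*ˡ {n} (+ 3) _) (Σᶠ-+ {n} _ _)) ⟩
  + 3 * (I n · v) i + (Σᶠ (λ l → - (T⁻¹ n i l * v l)) + Σᶠ (λ l → - (T n i l * v l)))
    ≡⟨ cong (_+_ (+ 3 * (I n · v) i)) (cong₂ _+_ (Σᶠ-neg {n} _) (Σᶠ-neg {n} _)) ⟩
  + 3 * (I n · v) i + (- (T⁻¹ n · v) i + - (T n · v) i)
    ≡⟨ collect (+ 3 * (I n · v) i) ((T⁻¹ n · v) i) ((T n · v) i) ⟩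
  + 3 * (I n · v) i - (T⁻¹ n · v) i - (T n · v) i ∎
  where
  expand : ∀ x y z v → (+ 3 * x - y - z) * v ≡ + 3 * (x * v) + (- (y * v) + - (z * v))
  expand = solve-∀
  collect : ∀ x y z → x + (- y + - z) ≡ x - y - z
  collect = solve-∀

module _ (m : ℕ) (V : ℕ → ℤ) (j : Fin (suc m)) where

  private
    t = toℕ j
    t≤m = ℕₚ.≤-pred (toℕ<n j)

  I·↾ : (I (suc m) · (V ↾)) j ≡ V t
  I·↾ = trans (Σᶠ-cong {suc m} (λ l → cong (_* V (toℕ l)) (δ-sym t (toℕ l)))) (Σᶠ-δ j (V ↾))

  T·↾ : (T (suc m) · (V ↾)) j ≡ V (next m t)
  T·↾ = Σᶠ-δ↾ V (m%n<n (suc t) (suc m))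

  T⁻¹·↾ : (T⁻¹ (suc m) · (V ↾)) j ≡ V (prev m t)
  T⁻¹·↾ = trans (Σᶠ-cong {suc m} (λ l → cong (_* V (toℕ l)) (to-prev l))) (Σᶠ-δ↾ V (s≤s (prev-≤ t≤m)))
    where
    to-prev : ∀ l → δ t (next m (toℕ l)) ≡ δ (toℕ l) (prev m t)
    to-prev l = trans (sym (δ-prev-next t≤m (ℕₚ.≤-pred (toℕ<n l)))) (δ-sym (prev m t) (toℕ l))

  A·↾ : (A (suc m) · (V ↾)) j ≡ + 3 * V t - V (prev m t) - V (next m t)
  A·↾ = trans (A·≡ (suc m) (V ↾) j) (cong₂ _-_ (cong₂ (λ x y → + 3 * x - y) I·↾ T⁻¹·↾) T·↾)

A-sym : ∀ n i j → A n i j ≡ A n j i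
A-sym n i j = trans (cong (λ x → + 3 * x - T⁻¹ n i j - T n i j) (δ-sym (toℕ i) (toℕ j)))
                    (swap (+ 3 * I n j i) (T⁻¹ n i j) (T n i j))
  where
  swap : ∀ x y z → x - y - z ≡ x - z - y
  swap = solve-∀

Recurrent : (ℕ → ℤ) → Set
Recurrent V = ∀ k → V (suc (suc k)) ≡ + 3 * V (suc k) - V k

recSeq : ℤ → ℤ → ℕ → ℤ
recSeq p q zero    = p
recSeq p q (suc k) = recSeq q (+ 3 * q - p) k

recSeq-recurrent : ∀ p q → Recurrent (recSeq p q)
recSeq-recurrent p q zero    = refl
recSeq-recurrent p q (suc k) = recSeq-recurrent q (+ 3 * q - p) k

-- With V₋₁ = 3 V₀ - V₁, these are V₋₁ - Vₘ and Vₘ₊₁ - V₀: the failure of V to be (m+1)-periodic.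
∂₀ ∂₁ : ℕ → (ℕ → ℤ) → ℤ
∂₀ m V = + 3 * V 0 - V 1 - V m
∂₁ m V = V (suc m) - V 0

A·recurrent : ∀ m {V} → Recurrent V → ∀ j → (A (suc m) · (V ↾)) j ≡ ∂₀ m V * e 0 j + ∂₁ m V * e m j
A·recurrent m {V} V-rec j = trans (A·↾ m V j) (boundary m (toℕ j) (ℕₚ.≤-pred (toℕ<n j)))
  where
  boundary : ∀ m t → t ≤ m → + 3 * V t - V (prev m t) - V (next m t) ≡ ∂₀ m V * δ t 0 + ∂₁ m V * δ t m
  boundary zero    zero _ = single (V 0) (V 1)
    where
    single : ∀ x y → + 3 * x - x - x ≡ (+ 3 * x - y - x) * 1ℤ + (y - x) * 1ℤ
    single = solve-∀
  boundary (suc m) zero _ rewrite next-< {suc m} {0} (s≤s z≤n) =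
    first (V 0) (V 1) (V (suc m)) (V (suc (suc m)))
    where
    first : ∀ x y z w → + 3 * x - z - y ≡ (+ 3 * x - y - z) * 1ℤ + (w - x) * 0ℤ
    first = solve-∀
  boundary m (suc t) st≤m with suc t ℕ.≟ m
  ... | yes refl rewrite next-last (suc t) | δ-refl t | V-rec t = last (V 0) (V 1) (V t) (V (suc t))
    where
    last : ∀ x y a b → + 3 * b - a - x ≡ (+ 3 * x - y - b) * 0ℤ + (+ 3 * b - a - x) * 1ℤ
    last = solve-∀
  ... | no st≢m rewrite next-< (ℕₚ.≤∧≢⇒< st≤m st≢m) | δ-≢ st≢m | V-rec t =
    interior (∂₀ m V) (∂₁ m V) (V t) (V (suc t))
    where
    interior : ∀ p q a b → + 3 * b - a - (+ 3 * b - a) ≡ p * 0ℤ + q * 0ℤ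
    interior = solve-∀

A·e : ∀ m {k} → k ≤ m → ∀ j → (A (suc m) · e k) j ≡ + 3 * e k j - e (next m k) j - e (prev m k) j
A·e m {k} k≤m j =
  trans (A·↾ m (λ l → δ l k) j) (cong₂ (λ x y → + 3 * δ t k - x - y) (δ-prev-next t≤m k≤m) flip)
  where
  t = toℕ j
  t≤m = ℕₚ.≤-pred (toℕ<n j)
  flip : δ (next m t) k ≡ δ t (prev m k)
  flip = trans (δ-sym (next m t) k) (trans (sym (δ-prev-next k≤m t≤m)) (δ-sym (prev m k) t))

⟨↾,e⟩ : ∀ {n k} (V : ℕ → ℤ) → k < n → ⟨ V ↾ , e {n} k ⟩ ≡ V k
⟨↾,e⟩ {n} V k<n = trans (Σᶠ-cong {n} (λ i → *-comm (V (toℕ i)) _)) (Σᶠ-δ↾ V k<n)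

-- Data for a CokerSplitting of A(m+1) with u = u₀ e₀ + u₁ eₘ, w = w₀ e₀ + w₁ eₘ, functionals
-- c = recSeq c₀ c₁, d = recSeq d₀ d₁, and preimages recSeq zu₀ zu₁ of a u and recSeq zw₀ zw₁ of b w.
-- As a ∣ ∂₀ c gives cₘ ≡ 3c₀ - c₁, the last eight fields say that (c₀ , 3c₀ - c₁ / d₀ , 3d₀ - d₁)
-- and (u₀ , w₀ / u₁ , w₁) are mutually inverse 2 × 2 matrices.
record ShiftSplitting (m a b : ℕ) : Set where
  field
    c₀ c₁ d₀ d₁ u₀ u₁ w₀ w₁ zu₀ zu₁ zw₀ zw₁ : ℤ
    a∣∂₀c    : + a ∣ ∂₀ m (recSeq c₀ c₁)
    a∣∂₁c    : + a ∣ ∂₁ m (recSeq c₀ c₁)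
    b∣∂₀d    : + b ∣ ∂₀ m (recSeq d₀ d₁)
    b∣∂₁d    : + b ∣ ∂₁ m (recSeq d₀ d₁)
    ∂₀zu     : ∂₀ m (recSeq zu₀ zu₁) ≡ + a * u₀
    ∂₁zu     : ∂₁ m (recSeq zu₀ zu₁) ≡ + a * u₁
    ∂₀zw     : ∂₀ m (recSeq zw₀ zw₁) ≡ + b * w₀
    ∂₁zw     : ∂₁ m (recSeq zw₀ zw₁) ≡ + b * w₁
    c-u      : c₀ * u₀ + (+ 3 * c₀ - c₁) * u₁ ≡ 1ℤ
    c-w      : c₀ * w₀ + (+ 3 * c₀ - c₁) * w₁ ≡ 0ℤ
    d-u      : d₀ * u₀ + (+ 3 * d₀ - d₁) * u₁ ≡ 0ℤ
    d-w      : d₀ * w₀ + (+ 3 * d₀ - d₁) * w₁ ≡ 1ℤ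
    e₀-span₀ : c₀ * u₀ + d₀ * w₀ ≡ 1ℤ
    e₀-spanₘ : c₀ * u₁ + d₀ * w₁ ≡ 0ℤ
    eₘ-span₀ : (+ 3 * c₀ - c₁) * u₀ + (+ 3 * d₀ - d₁) * w₀ ≡ 0ℤ
    eₘ-spanₘ : (+ 3 * c₀ - c₁) * u₁ + (+ 3 * d₀ - d₁) * w₁ ≡ 1ℤ

module _ {m a b : ℕ} (S : ShiftSplitting m a b) where
  open ShiftSplitting S

  private
    N : ℕ
    N = suc m

    _e₀+_eₘ : ℤ → ℤ → Vec N
    (x₀ e₀+ x₁ eₘ) i = x₀ * e 0 i + x₁ * e m i

    u w : Vec N
    u = u₀ e₀+ u₁ eₘ
    w = w₀ e₀+ w₁ eₘ

    pairing : ∀ {k r x₀ x₁} V → + k ∣ ∂₀ m V → V 0 * x₀ + (+ 3 * V 0 - V 1) * x₁ ≡ r →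
              + k ∣ ⟨ V ↾ , (x₀ e₀+ x₁ eₘ) ⟩ - r
    pairing {k} {r} {x₀} {x₁} V k∣∂₀ eq = subst (_ ∣_) (sym (begin
      ⟨ V ↾ , (x₀ e₀+ x₁ eₘ) ⟩ - r
        ≡⟨ cong (_- r) (⟨⟩-linʳ (_↾ {N} V) x₀ x₁ (e 0) (e m)) ⟩
      x₀ * ⟨ V ↾ , e {N} 0 ⟩ + x₁ * ⟨ V ↾ , e {N} m ⟩ - r
        ≡⟨ cong₂ (λ p q → x₀ * p + x₁ * q - r) (⟨↾,e⟩ {N} V (s≤s z≤n)) (⟨↾,e⟩ {N} V (ℕₚ.n<1+n m)) ⟩
      x₀ * V 0 + x₁ * V m - r
        ≡⟨ regroup x₀ x₁ (V 0) (V 1) (V m) r ⟩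
      V 0 * x₀ + (+ 3 * V 0 - V 1) * x₁ - r - x₁ * ∂₀ m V
        ≡⟨ cong (λ p → p - r - x₁ * ∂₀ m V) eq ⟩
      r - r - x₁ * ∂₀ m V
        ≡⟨ cancel r (x₁ * ∂₀ m V) ⟩
      - (x₁ * ∂₀ m V) ∎))
      (∣m⇒∣-m (∣n⇒∣m*n x₁ k∣∂₀))
      where
      regroup : ∀ x₀ x₁ v₀ v₁ vₘ r →
                x₀ * v₀ + x₁ * vₘ - r ≡ v₀ * x₀ + (+ 3 * v₀ - v₁) * x₁ - r - x₁ * (+ 3 * v₀ - v₁ - vₘ)
      regroup = solve-∀
      cancel : ∀ r y → r - r - y ≡ - y
      cancel = solve-∀

    image-∣ : ∀ {k} p q → + k ∣ ∂₀ m (recSeq p q) → + k ∣ ∂₁ m (recSeq p q) →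
              ∀ v → + k ∣ ⟨ recSeq p q ↾ , A N · v ⟩
    image-∣ p q k∣∂₀ k∣∂₁ v = subst (_ ∣_) (sym (⟨⟩-symmetric (A N) (A-sym N) (recSeq p q ↾) v))
      (⟨⟩-∣ (A N · (recSeq p q ↾)) v λ i →
        subst (_ ∣_) (sym (A·recurrent m {recSeq p q} (recSeq-recurrent p q) i))
          (∣m∣n⇒∣m+n (∣m⇒∣m*n (e 0 i) k∣∂₀) (∣m⇒∣m*n (e m i) k∣∂₁)))

    preimage : ∀ {k x₀ x₁} p q → ∂₀ m (recSeq p q) ≡ + k * x₀ → ∂₁ m (recSeq p q) ≡ + k * x₁ →
               Im (A N) (λ i → + k * (x₀ e₀+ x₁ eₘ) i)
    preimage {k} {x₀} {x₁} p q ∂₀≡ ∂₁≡ = recSeq p q ↾ , λ i → sym (begin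
      (A N · (recSeq p q ↾)) i
        ≡⟨ A·recurrent m {recSeq p q} (recSeq-recurrent p q) i ⟩
      ∂₀ m (recSeq p q) * e 0 i + ∂₁ m (recSeq p q) * e m i
        ≡⟨ cong₂ (λ y z → y * e 0 i + z * e m i) ∂₀≡ ∂₁≡ ⟩
      + k * x₀ * e 0 i + + k * x₁ * e m i
        ≡⟨ factor (+ k) x₀ x₁ (e 0 i) (e m i) ⟩
      + k * (x₀ e₀+ x₁ eₘ) i ∎)
      where
      factor : ∀ k x₀ x₁ y z → k * x₀ * y + k * x₁ * z ≡ k * (x₀ * y + x₁ * z)
      factor = solve-∀

    Spanned′ : Vec N → Set
    Spanned′ = Spanned (A N) u w

    spanned-e₀eₘ : ∀ {x} s t p q → s * u₀ + t * w₀ ≡ p → s * u₁ + t * w₁ ≡ q →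
                   (∀ i → x i ≡ (p e₀+ q eₘ) i) → Spanned′ x
    spanned-e₀eₘ {x} s t p q ≡p ≡q x≗ = s , t , Im-resp (A N) vanish (Im-0 (A N))
      where
      regroup : ∀ s t u₀ u₁ w₀ w₁ y z →
                s * (u₀ * y + u₁ * z) + t * (w₀ * y + w₁ * z)
                ≡ (s * u₀ + t * w₀) * y + (s * u₁ + t * w₁) * z
      regroup = solve-∀
      vanish : ∀ i → 0ℤ ≡ x i - (s * u i + t * w i)
      vanish i = sym (begin
        x i - (s * u i + t * w i)
          ≡⟨ cong₂ _-_ (x≗ i) (regroup s t u₀ u₁ w₀ w₁ (e 0 i) (e m i)) ⟩
        (p e₀+ q eₘ) i - ((s * u₀ + t * w₀) e₀+ (s * u₁ + t * w₁) eₘ) i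
          ≡⟨ cong₂ (λ y z → (p e₀+ q eₘ) i - (y e₀+ z eₘ) i) ≡p ≡q ⟩
        (p e₀+ q eₘ) i - (p e₀+ q eₘ) i
          ≡⟨ +-inverseʳ ((p e₀+ q eₘ) i) ⟩
        0ℤ ∎)

    spanned-e₀ : Spanned′ (e 0)
    spanned-e₀ = spanned-e₀eₘ c₀ d₀ 1ℤ 0ℤ e₀-span₀ e₀-spanₘ (λ i → unit (e 0 i) (e m i))
      where
      unit : ∀ y z → y ≡ 1ℤ * y + 0ℤ * z
      unit = solve-∀

    spanned-eₘ : Spanned′ (e m)
    spanned-eₘ = spanned-e₀eₘ (+ 3 * c₀ - c₁) (+ 3 * d₀ - d₁) 0ℤ 1ℤ eₘ-span₀ eₘ-spanₘ
                              (λ i → unit (e 0 i) (e m i))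
      where
      unit : ∀ y z → z ≡ 0ℤ * y + 1ℤ * z
      unit = solve-∀

    spanned-next : ∀ {k} → k ≤ m → Spanned′ (e k) → Spanned′ (e (prev m k)) → Spanned′ (e (next m k))
    spanned-next {k} k≤m eₖ eₚ =
      Spanned-lin (A N) (+ 3) -1ℤ {e k} {e (prev m k)} eₖ eₚ
        ((λ i → - e k i) , λ i → sym (·-neg (A N) (e k) i))
        (λ i → trans (isolate (e k i) (e (next m k) i) (e (prev m k) i))
                     (cong (λ y → + 3 * e k i + -1ℤ * e (prev m k) i + - y) (sym (A·e m k≤m i))))
      where
      isolate : ∀ x y z → y ≡ + 3 * x + -1ℤ * z + - (+ 3 * x - y - z)
      isolate = solve-∀

    spanned-pair : ∀ k → k < m → Spanned′ (e k) × Spanned′ (e (suc k))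
    spanned-pair zero 0<m =
      spanned-e₀ , subst (Spanned′ ∘ e) (next-< 0<m) (spanned-next z≤n spanned-e₀ spanned-eₘ)
    spanned-pair (suc k) k+1<m with spanned-pair k (ℕₚ.≤-trans (ℕₚ.n≤1+n _) k+1<m)
    ... | eₖ , eₖ₊₁ = eₖ₊₁ , subst (Spanned′ ∘ e) (next-< k+1<m) (spanned-next (ℕₚ.<⇒≤ k+1<m) eₖ₊₁ eₖ)

    spanned-e : ∀ (j : Fin N) → Spanned′ (e (toℕ j))
    spanned-e j = go (toℕ j) (ℕₚ.≤-pred (toℕ<n j))
      where
      go : ∀ k → k ≤ m → Spanned′ (e k)
      go zero    _    = spanned-e₀
      go (suc k) k<m = proj₂ (spanned-pair k k<m)

  shift⇒splitting : CokerSplitting (A N) a b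
  shift⇒splitting = record
    { c = recSeq c₀ c₁ ↾
    ; d = recSeq d₀ d₁ ↾
    ; u = u
    ; w = w
    ; c-image = image-∣ c₀ c₁ a∣∂₀c a∣∂₁c
    ; d-image = image-∣ d₀ d₁ b∣∂₀d b∣∂₁d
    ; au-image = preimage {a} zu₀ zu₁ ∂₀zu ∂₁zu
    ; bw-image = preimage {b} zw₀ zw₁ ∂₀zw ∂₁zw
    ; c-u = pairing (recSeq c₀ c₁) a∣∂₀c c-u
    ; c-w = subst (_ ∣_) (+-identityʳ _) (pairing (recSeq c₀ c₁) a∣∂₀c c-w)
    ; d-u = subst (_ ∣_) (+-identityʳ _) (pairing (recSeq d₀ d₁) b∣∂₀d d-u)
    ; d-w = pairing (recSeq d₀ d₁) b∣∂₀d d-w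
    ; spans = spanned-e
    }

F : ℕ → ℤ
F k = + fib k

-- recSeq p q m = q F₂ₘ - p F₂ₘ₋₂, by the doubling formulas F₂ₘ = Fₘ (2 Fₘ₊₁ - Fₘ) and
-- F₂ₘ₋₂ = Fₘ₋₁ (3 Fₘ - Fₘ₊₁).
recSeq-fib : ∀ m p q → recSeq p q m ≡ q * (F m * (+ 2 * F (suc m) - F m))
                                      - p * ((F (suc m) - F m) * (+ 3 * F m - F (suc m)))
recSeq-fib zero    p q = base p q
  where
  base : ∀ p q → p ≡ q * (0ℤ * (+ 2 * 1ℤ - 0ℤ)) - p * ((1ℤ - 0ℤ) * (+ 3 * 0ℤ - 1ℤ))
  base = solve-∀
recSeq-fib (suc m) p q = trans (recSeq-fib m q (+ 3 * q - p)) (step p q (F m) (F (suc m)))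
  where
  step : ∀ p q x y → (+ 3 * q - p) * (x * (+ 2 * y - x)) - q * ((y - x) * (+ 3 * x - y))
                     ≡ q * (y * (+ 2 * (y + x) - y)) - p * ((y + x - y) * (+ 3 * y - (y + x)))
  step = solve-∀

Cassini : ℕ → ℤ
Cassini m = F m * F m + F m * F (suc m) - F (suc m) * F (suc m)

Cassini-suc : ∀ m → Cassini (suc m) ≡ - Cassini m
Cassini-suc m = flip (F m) (F (suc m))
  where
  flip : ∀ x y → y * y + y * (y + x) - (y + x) * (y + x) ≡ - (x * x + x * y - y * y)
  flip = solve-∀

Cassini-even : ∀ k → Cassini (k ℕ.* 2) ≡ -1ℤ
Cassini-odd  : ∀ k → Cassini (suc (k ℕ.* 2)) ≡ 1ℤ
Cassini-even zero    = refl
Cassini-even (suc k) = trans (Cassini-suc (suc (k ℕ.* 2))) (cong -_ (Cassini-odd k))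
Cassini-odd k        = trans (Cassini-suc (k ℕ.* 2)) (cong -_ (Cassini-even k))

lucas≡ : ∀ m → + lucas (suc m) ≡ + 2 * F m + F (suc m)
lucas≡ zero          = refl
lucas≡ (suc zero)    = refl
lucas≡ (suc (suc m)) = trans (cong₂ _+_ (lucas≡ (suc m)) (lucas≡ m)) (step (F m) (F (suc m)))
  where
  step : ∀ x y → (+ 2 * y + (y + x)) + (+ 2 * x + y) ≡ + 2 * (y + x) + ((y + x) + y)
  step = solve-∀

module _ (m : ℕ) (p q : ℤ) where
  private
    X Y : ℤ
    X = F m
    Y = F (suc m)

  ∂₀-fib : ∂₀ m (recSeq p q) ≡ + 3 * p - q - (q * (X * (+ 2 * Y - X)) - p * ((Y - X) * (+ 3 * X - Y)))
  ∂₀-fib = cong (_-_ (+ 3 * p - q)) (recSeq-fib m p q)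

  ∂₁-fib : ∂₁ m (recSeq p q) ≡ (+ 3 * q - p) * (X * (+ 2 * Y - X)) - q * ((Y - X) * (+ 3 * X - Y)) - p
  ∂₁-fib = cong (_- p) (recSeq-fib m q (+ 3 * q - p))

modulo-Cassini : ∀ {ε x y} m r → Cassini m ≡ ε → x ≡ y + r * (Cassini m - ε) → x ≡ y
modulo-Cassini {ε} {y = y} m r refl x≡ = trans x≡ (vanish y r ε)
  where
  vanish : ∀ y r ε → y + r * (ε - ε) ≡ y
  vanish = solve-∀

∣-by : ∀ {k x} y → x ≡ k * y → k ∣ x
∣-by {k} y x≡ky = divides y (trans x≡ky (*-comm k y))

-- For odd n the boundary map (p , q) ↦ (∂₀ , ∂₁) of recSeq p q is Lₙ K with det K = - Cassini = 1.
-- So u = e₀, w = eₘ, the functionals are the coordinates eₖ ≡ cₖ e₀ + dₖ eₘ, and the preimage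
-- seeds are the columns of K⁻¹.
module OddLength (k : ℕ) where
  private
    m : ℕ
    m = k ℕ.* 2
    X Y L : ℤ
    X = F m
    Y = F (suc m)
    L = + lucas (suc m)

    by-Cassini : ∀ {x} r K → x ≡ (+ 2 * X + Y) * K + r * (Cassini m - -1ℤ) → x ≡ L * K
    by-Cassini r K x≡ = trans (modulo-Cassini m r (Cassini-even k) x≡) (cong (_* K) (sym (lucas≡ m)))

    ∂₀-odd : ∀ p q → ∂₀ m (recSeq p q) ≡ L * (p * (+ 2 * Y - + 3 * X) + q * (X - Y))
    ∂₀-odd p q = trans (∂₀-fib m p q) (by-Cassini (+ 3 * p - q) _ (identity p q X Y))
      where
      identity : ∀ p q x y →
        + 3 * p - q - (q * (x * (+ 2 * y - x)) - p * ((y - x) * (+ 3 * x - y)))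
        ≡ (+ 2 * x + y) * (p * (+ 2 * y - + 3 * x) + q * (x - y))
          + (+ 3 * p - q) * (x * x + x * y - y * y - -1ℤ)
      identity = solve-∀

    ∂₁-odd : ∀ p q → ∂₁ m (recSeq p q) ≡ L * (p * (X - Y) + q * Y)
    ∂₁-odd p q = trans (∂₁-fib m p q) (by-Cassini (- p) _ (identity p q X Y))
      where
      identity : ∀ p q x y →
        (+ 3 * q - p) * (x * (+ 2 * y - x)) - q * ((y - x) * (+ 3 * x - y)) - p
        ≡ (+ 2 * x + y) * (p * (x - y) + q * y) + - p * (x * x + x * y - y * y - -1ℤ)
      identity = solve-∀

    ×Cassini : ∀ {z} t → z ≡ t * Cassini m → z ≡ - t
    ×Cassini t z≡ = trans z≡ (trans (cong (t *_) (Cassini-even k)) (trans (*-comm t -1ℤ) (-1*i≡-i t)))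

  splitting : ShiftSplitting m (lucas (suc m)) (lucas (suc m))
  splitting = record
    { c₀ = 1ℤ ; c₁ = + 3 ; d₀ = 0ℤ ; d₁ = -1ℤ
    ; u₀ = 1ℤ ; u₁ = 0ℤ ; w₀ = 0ℤ ; w₁ = 1ℤ
    ; zu₀ = Y ; zu₁ = Y - X ; zw₀ = Y - X ; zw₁ = + 2 * Y - + 3 * X
    ; a∣∂₀c = ∣-by _ (∂₀-odd 1ℤ (+ 3))
    ; a∣∂₁c = ∣-by _ (∂₁-odd 1ℤ (+ 3))
    ; b∣∂₀d = ∣-by _ (∂₀-odd 0ℤ -1ℤ)
    ; b∣∂₁d = ∣-by _ (∂₁-odd 0ℤ -1ℤ)
    ; ∂₀zu = trans (∂₀-odd Y (Y - X)) (cong (L *_) (×Cassini -1ℤ (zu₀-identity X Y)))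
    ; ∂₁zu = trans (∂₁-odd Y (Y - X)) (cong (L *_) (zu₁-identity X Y))
    ; ∂₀zw = trans (∂₀-odd (Y - X) (+ 2 * Y - + 3 * X)) (cong (L *_) (zw₀-identity X Y))
    ; ∂₁zw = trans (∂₁-odd (Y - X) (+ 2 * Y - + 3 * X)) (cong (L *_) (×Cassini -1ℤ (zw₁-identity X Y)))
    ; c-u = refl ; c-w = refl ; d-u = refl ; d-w = refl
    ; e₀-span₀ = refl ; e₀-spanₘ = refl ; eₘ-span₀ = refl ; eₘ-spanₘ = refl
    }
    where
    zu₀-identity : ∀ x y → y * (+ 2 * y - + 3 * x) + (y - x) * (x - y) ≡ -1ℤ * (x * x + x * y - y * y)
    zu₀-identity = solve-∀
    zu₁-identity : ∀ x y → y * (x - y) + (y - x) * y ≡ 0ℤ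
    zu₁-identity = solve-∀
    zw₀-identity : ∀ x y → (y - x) * (+ 2 * y - + 3 * x) + (+ 2 * y - + 3 * x) * (x - y) ≡ 0ℤ
    zw₀-identity = solve-∀
    zw₁-identity : ∀ x y → (y - x) * (x - y) + (+ 2 * y - + 3 * x) * y ≡ -1ℤ * (x * x + x * y - y * y)
    zw₁-identity = solve-∀

-- For even n the boundary map is Fₙ K with det K = 5 Cassini = 5; u and w are chosen so that the
-- preimage seeds K⁻¹ u and K⁻¹ (5 w) are integral.
module EvenLength (k : ℕ) where
  private
    m : ℕ
    m = suc (k ℕ.* 2)
    X Y : ℤ
    X = F m
    Y = F (suc m)

    by-Cassini : ∀ {x} r K → x ≡ Y * K + r * (Cassini m - 1ℤ) → x ≡ Y * K
    by-Cassini r K = modulo-Cassini m r (Cassini-odd k)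

    ∂₀-even : ∀ p q → ∂₀ m (recSeq p q) ≡ Y * (p * (+ 7 * X - + 4 * Y) + q * (Y - + 3 * X))
    ∂₀-even p q = trans (∂₀-fib m p q) (by-Cassini (q - + 3 * p) _ (identity p q X Y))
      where
      identity : ∀ p q x y →
        + 3 * p - q - (q * (x * (+ 2 * y - x)) - p * ((y - x) * (+ 3 * x - y)))
        ≡ y * (p * (+ 7 * x - + 4 * y) + q * (y - + 3 * x))
          + (q - + 3 * p) * (x * x + x * y - y * y - 1ℤ)
      identity = solve-∀

    ∂₁-even : ∀ p q → ∂₁ m (recSeq p q) ≡ Y * (p * (Y - + 3 * X) + q * (+ 2 * X + Y))
    ∂₁-even p q = trans (∂₁-fib m p q) (by-Cassini p _ (identity p q X Y))
      where
      identity : ∀ p q x y →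
        (+ 3 * q - p) * (x * (+ 2 * y - x)) - q * ((y - x) * (+ 3 * x - y)) - p
        ≡ y * (p * (y - + 3 * x) + q * (+ 2 * x + y)) + p * (x * x + x * y - y * y - 1ℤ)
      identity = solve-∀

    ×Cassini : ∀ {z} t → z ≡ t * Cassini m → z ≡ t
    ×Cassini t z≡ = trans z≡ (trans (cong (t *_) (Cassini-odd k)) (*-identityʳ t))

    5F : ∀ t → Y * (+ 5 * t) ≡ + (5 ℕ.* fib (suc m)) * t
    5F t = trans (reassoc Y t) (cong (_* t) (sym (pos-* 5 (fib (suc m)))))
      where
      reassoc : ∀ y t → y * (+ 5 * t) ≡ + 5 * y * t
      reassoc = solve-∀

    5F-Cassini : ∀ {x z} t → x ≡ Y * z → z ≡ + 5 * t * Cassini m → x ≡ + (5 ℕ.* fib (suc m)) * t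
    5F-Cassini t x≡ z≡ = trans x≡ (trans (cong (Y *_) (×Cassini (+ 5 * t) z≡)) (5F t))

  splitting : ShiftSplitting m (fib (suc m)) (5 ℕ.* fib (suc m))
  splitting = record
    { c₀ = 1ℤ ; c₁ = 1ℤ ; d₀ = + 2 ; d₁ = + 3
    ; u₀ = - + 3 ; u₁ = + 2 ; w₀ = + 2 ; w₁ = -1ℤ
    ; zu₀ = - Y ; zu₁ = X - Y ; zw₀ = X + + 3 * Y ; zw₁ = + 2 * Y - X
    ; a∣∂₀c = ∣-by _ (∂₀-even 1ℤ 1ℤ)
    ; a∣∂₁c = ∣-by _ (∂₁-even 1ℤ 1ℤ)
    ; b∣∂₀d = ∣-by (X - Y)
                (trans (∂₀-even (+ 2) (+ 3)) (trans (cong (Y *_) (d₀-identity X Y)) (5F (X - Y))))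
    ; b∣∂₁d = ∣-by Y (trans (∂₁-even (+ 2) (+ 3)) (trans (cong (Y *_) (d₁-identity X Y)) (5F Y)))
    ; ∂₀zu = trans (∂₀-even (- Y) (X - Y)) (cong (Y *_) (×Cassini (- + 3) (zu₀-identity X Y)))
    ; ∂₁zu = trans (∂₁-even (- Y) (X - Y)) (cong (Y *_) (×Cassini (+ 2) (zu₁-identity X Y)))
    ; ∂₀zw = 5F-Cassini (+ 2) (∂₀-even (X + + 3 * Y) (+ 2 * Y - X)) (zw₀-identity X Y)
    ; ∂₁zw = 5F-Cassini -1ℤ (∂₁-even (X + + 3 * Y) (+ 2 * Y - X)) (zw₁-identity X Y)
    ; c-u = refl ; c-w = refl ; d-u = refl ; d-w = refl
    ; e₀-span₀ = refl ; e₀-spanₘ = refl ; eₘ-span₀ = refl ; eₘ-spanₘ = refl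
    }
    where
    d₀-identity : ∀ x y → + 2 * (+ 7 * x - + 4 * y) + + 3 * (y - + 3 * x) ≡ + 5 * (x - y)
    d₀-identity = solve-∀
    d₁-identity : ∀ x y → + 2 * (y - + 3 * x) + + 3 * (+ 2 * x + y) ≡ + 5 * y
    d₁-identity = solve-∀
    zu₀-identity : ∀ x y → - y * (+ 7 * x - + 4 * y) + (x - y) * (y - + 3 * x)
                           ≡ - + 3 * (x * x + x * y - y * y)
    zu₀-identity = solve-∀
    zu₁-identity : ∀ x y → - y * (y - + 3 * x) + (x - y) * (+ 2 * x + y) ≡ + 2 * (x * x + x * y - y * y)
    zu₁-identity = solve-∀
    zw₀-identity : ∀ x y → (x + + 3 * y) * (+ 7 * x - + 4 * y) + (+ 2 * y - x) * (y - + 3 * x)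
                           ≡ + 5 * + 2 * (x * x + x * y - y * y)
    zw₀-identity = solve-∀
    zw₁-identity : ∀ x y → (x + + 3 * y) * (y - + 3 * x) + (+ 2 * y - x) * (+ 2 * x + y)
                           ≡ + 5 * -1ℤ * (x * x + x * y - y * y)
    zw₁-identity = solve-∀

even-or-odd : ∀ m → (∃ λ k → m ≡ k ℕ.* 2) ⊎ (∃ λ k → m ≡ suc (k ℕ.* 2))
even-or-odd zero = inj₁ (0 , refl)
even-or-odd (suc m) with even-or-odd m
... | inj₁ (k , refl) = inj₂ (k , refl)
... | inj₂ (k , refl) = inj₁ (suc k , refl)

lemma1 : (n : ℕ) → 1 ≤ n →
    ((n % 2 ≡ 0 → Coker (A n) ≅ (ℤ/ (fib n) ⊕ ℤ/ (5 ℕ.* fib n)))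
    × (n % 2 ≡ 1 → Coker (A n) ≅ (ℤ/ (lucas n) ⊕ ℤ/ (lucas n))))
lemma1 (suc m) _ with even-or-odd m
... | inj₁ (k , refl) =
  (λ n%2≡0 → contradiction (trans (sym ([m+kn]%n≡m%n 1 k 2)) n%2≡0) λ ()) ,
  (λ _ → splitting⇒≅ (shift⇒splitting (OddLength.splitting k)))
... | inj₂ (k , refl) =
  (λ _ → splitting⇒≅ (shift⇒splitting (EvenLength.splitting k))) ,
  (λ n%2≡1 → contradiction (trans (sym ([m+kn]%n≡m%n 2 k 2)) n%2≡1) λ ())
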